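{- Let $k\geq 2$, $1\leq x\leq k-1$, $n=k+x$, with $(x,n)\notin\{(1,4),(1,6)\}$. If $x\geq \sqrt{k-1}$, then $\lambda^k(\overrightarrow{C_n})\leq x+2$.
   Context: $\overrightarrow{C_n}$ is the directed cycle (circuit) on $n$ vertices and $\overleftrightarrow{K_n}$ the complete digraph on $n$ vertices. A $p$-labeled packing of $k$ copies of $\overrightarrow{C_n}$ is a map $f$ from $V(\overleftrightarrow{K_n})$ onto a set of exactly $p$ labels together with injections $\sigma_1,\dots,\sigma_k:V(\overrightarrow{C_n})\to V(\overleftrightarrow{K_n})$ such that for $i\neq j$ the induced arc images are disjoint, and for every vertex $v$, $f(\sigma_1(v))=\dots=f(\sigma_k(v))$. $\lambda^k(\overrightarrow{C_n})$ is the largest $p$ for which such a packing exists. -}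

module Defs where

open import Data.Nat using (ℕ; zero; suc)
open import Data.Fin using (Fin; toℕ)
open import Data.Product using (Σ; ∃; _×_)
open import Data.Sum using (_⊎_)
open import Data.Empty using (⊥)
open import Relation.Binary.PropositionalEquality using (_≡_; _≢_)
open import Function.Definitions using (Injective)

-- Vertices of the directed cycle C_n are Fin n = {0,…,n-1};
-- its arcs are a → a+1 (mod n), i.e. a → a+1 for a+1 < n, and (n-1) → 0.
CycleArc : (n : ℕ) → Fin n → Fin n → Set
CycleArc n a b = (suc (toℕ a) ≡ toℕ b) ⊎ ((suc (toℕ a) ≡ n) × (toℕ b ≡ 0))

-- A p-labeled packing of k copies of C_n into the complete digraph K_n
-- (vertex set Fin n, all ordered pairs of distinct vertices are arcs).
record LabeledPacking (p k n : ℕ) : Set where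
  field
    label      : Fin n → Fin p
    label-onto : ∀ (l : Fin p) → ∃ λ v → label v ≡ l
    σ          : Fin k → Fin n → Fin n
    σ-inj      : ∀ i → Injective _≡_ _≡_ (σ i)
    arc-disj   : ∀ i j → i ≢ j → ∀ a b c d →
                 CycleArc n a b → CycleArc n c d →
                 σ i a ≡ σ j c → σ i b ≡ σ j d → ⊥
    label-eq   : ∀ i j v → label (σ i v) ≡ label (σ j v)

-- Let a be a label whose class is smallest, of size s ≥ 1, and t a vertex labelled a. In every
-- copy σᵢ the vertex t has an out-neighbour; these k heads are distinct because arcs of different
-- copies are disjoint, and as labels agree across copies, all their labels lie in the set B of
-- labels following label a along the first copy, which has at most s elements. So at most
-- n − k = x vertices carry a label outside B, and each such label has at least s vertices:
-- p ≤ s + x / s, which is at most x + 1 when s ≤ x. If s > x instead, s·p ≤ n ≤ x² + x + 1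
-- forces p ≤ x + 1 as well.
module Submission where

open import Defs
open import Data.Nat using (ℕ; _+_; _*_; _∸_; _≤_)
open import Data.Product using (_×_)
open import Relation.Binary.PropositionalEquality using (_≡_)
open import Relation.Nullary using (¬_)

open import Data.Nat using (zero; suc; z≤n; s≤s; z<s; _≤?_; _<?_)
open import Data.Nat.Properties
  using (≤-trans; ≤-antisym; <-irrefl; <⇒≱; ≰⇒>; ≮⇒≥; n≤1+n; m≤m+n; m<m+n; m≤m*n; m+[n∸m]≡n;
         +-comm; +-suc; +-identityʳ; +-monoʳ-≤; +-monoˡ-≤; +-mono-≤; +-cancelˡ-≤; *-monoˡ-≤; *-mono-≤;
         module ≤-Reasoning)
open import Data.Nat.Tactic.RingSolver using (solve-∀)
open import Data.Bool.Base using (true)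
open import Data.Fin.Base using (Fin; zero; suc; toℕ; fromℕ<)
open import Data.Fin.Properties using (_≟_; any?; suc-injective; 0≢1+n; toℕ-fromℕ<; toℕ≤pred[n])
open import Data.Fin.Subset
  using (Subset; inside; outside; _∈_; _∉_; _⊆_; _⊂_; ∁; _∩_; _─_; _-_; ⁅_⁆; ⊤; ∣_∣)
open import Data.Fin.Subset.Properties
  using (_∈?_; nonempty?; Empty-unique; ∣⊥∣≡0; ∣⊤∣≡n; ∣⁅x⁆∣≡1; ∣p∣≤n; ∣∁p∣≡n∸∣p∣; ∣p∩q∣≤∣q∣; p⊆q⇒∣p∣≤∣q∣;
         ∈⊤; x∈⁅x⁆; x∈⁅y⁆⇒x≡y; x∈∁p⇒x∉p; x∈p∩q⁺; x∈p∧x∉q⇒x∈p─q; p─q⊆p; x∈p∧x≢y⇒x∈p-y;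
         x∈p⇒p-x⊂p; x∈p⇒∣p-x∣<∣p∣)
open import Data.Fin.Subset.Induction using (⊂-wellFounded)
open import Data.List.Base using (allFin)
open import Data.List.Extrema.Nat using (argmin; f[argmin]≤f[xs])
open import Data.List.Membership.Propositional.Properties using (∈-allFin)
import Data.List.Relation.Unary.All as ListAll
open import Data.Vec.Base using ([]; _∷_; tabulate; here; there)
open import Data.Vec.Properties using (lookup∘tabulate; []=⇒lookup; lookup⇒[]=)
open import Data.Product using (∃; _,_; proj₁; proj₂)
open import Data.Sum using (inj₁; inj₂)
open import Data.Empty using (⊥-elim)
open import Function.Base using (_∘_)
open import Function.Definitions using (Injective)
import Induction.WellFounded as WF
open import Relation.Nullary using (Dec; yes; no; does; contradiction; _×-dec_)
open import Relation.Nullary.Decidable using (dec-true)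
open import Relation.Unary using (Pred; Decidable)
open import Relation.Binary.PropositionalEquality using (refl; trans; sym; cong; subst)

private
  variable
    m n : ℕ

∣p∣≡∣p∩q∣+∣p─q∣ : ∀ (p q : Subset n) → ∣ p ∣ ≡ ∣ p ∩ q ∣ + ∣ p ─ q ∣
∣p∣≡∣p∩q∣+∣p─q∣ []            []            = refl
∣p∣≡∣p∩q∣+∣p─q∣ (outside ∷ p) (inside  ∷ q) = ∣p∣≡∣p∩q∣+∣p─q∣ p q
∣p∣≡∣p∩q∣+∣p─q∣ (outside ∷ p) (outside ∷ q) = ∣p∣≡∣p∩q∣+∣p─q∣ p q
∣p∣≡∣p∩q∣+∣p─q∣ (inside  ∷ p) (inside  ∷ q) = cong suc (∣p∣≡∣p∩q∣+∣p─q∣ p q)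
∣p∣≡∣p∩q∣+∣p─q∣ (inside  ∷ p) (outside ∷ q) =
  trans (cong suc (∣p∣≡∣p∩q∣+∣p─q∣ p q)) (sym (+-suc ∣ p ∩ q ∣ ∣ p ─ q ∣))

∣p∣+∣∁p∣≡n : ∀ (p : Subset n) → ∣ p ∣ + ∣ ∁ p ∣ ≡ n
∣p∣+∣∁p∣≡n p = trans (cong (∣ p ∣ +_) (∣∁p∣≡n∸∣p∣ p)) (m+[n∸m]≡n (∣p∣≤n p))

∣p∣≤1+∣p-x∣ : ∀ (p : Subset n) x → ∣ p ∣ ≤ suc ∣ p - x ∣
∣p∣≤1+∣p-x∣ p x = begin
  ∣ p ∣                      ≡⟨ ∣p∣≡∣p∩q∣+∣p─q∣ p ⁅ x ⁆ ⟩
  ∣ p ∩ ⁅ x ⁆ ∣ + ∣ p - x ∣  ≤⟨ +-monoˡ-≤ ∣ p - x ∣ (∣p∩q∣≤∣q∣ p ⁅ x ⁆) ⟩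
  ∣ ⁅ x ⁆ ∣ + ∣ p - x ∣      ≡⟨ cong (_+ ∣ p - x ∣) (∣⁅x⁆∣≡1 x) ⟩
  suc ∣ p - x ∣              ∎
  where open ≤-Reasoning

x∈p─q⇒x∉q : ∀ {p q : Subset n} {x} → x ∈ p ─ q → x ∉ q
x∈p─q⇒x∉q {p = _ ∷ _} {inside  ∷ _} (there x∈p─q) (there x∈q) = x∈p─q⇒x∉q x∈p─q x∈q
x∈p─q⇒x∉q {p = _ ∷ _} {outside ∷ _} (there x∈p─q) (there x∈q) = x∈p─q⇒x∉q x∈p─q x∈q

disjoint⇒∣p∣+∣q∣≤∣r∣ : ∀ {p q r : Subset n} → p ⊆ r → q ⊆ r → (∀ {x} → x ∈ q → x ∉ p) →
                       ∣ p ∣ + ∣ q ∣ ≤ ∣ r ∣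
disjoint⇒∣p∣+∣q∣≤∣r∣ {p = p} {q} {r} p⊆r q⊆r q∩p=∅ = begin
  ∣ p ∣ + ∣ q ∣          ≤⟨ +-mono-≤ (p⊆q⇒∣p∣≤∣q∣ (λ x∈p → x∈p∩q⁺ (p⊆r x∈p , x∈p)))
                                     (p⊆q⇒∣p∣≤∣q∣ (λ x∈q → x∈p∧x∉q⇒x∈p─q (q⊆r x∈q) (q∩p=∅ x∈q))) ⟩
  ∣ r ∩ p ∣ + ∣ r ─ p ∣  ≡⟨ ∣p∣≡∣p∩q∣+∣p─q∣ r p ⟨
  ∣ r ∣                  ∎
  where open ≤-Reasoning

injectiveOn⇒∣p∣≤∣q∣ : ∀ {p : Subset m} {q : Subset n} (f : ∀ i → i ∈ p → Fin n) →
                      (∀ i (i∈p : i ∈ p) → f i i∈p ∈ q) →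
                      (∀ {i j} (i∈p : i ∈ p) (j∈p : j ∈ p) → f i i∈p ≡ f j j∈p → i ≡ j) →
                      ∣ p ∣ ≤ ∣ q ∣
injectiveOn⇒∣p∣≤∣q∣ {p = []}          f maps inj = z≤n
injectiveOn⇒∣p∣≤∣q∣ {p = outside ∷ p} f maps inj =
  injectiveOn⇒∣p∣≤∣q∣ (λ i i∈p → f (suc i) (there i∈p)) (λ i i∈p → maps (suc i) (there i∈p))
    (λ i∈p j∈p eq → suc-injective (inj (there i∈p) (there j∈p) eq))
injectiveOn⇒∣p∣≤∣q∣ {p = inside  ∷ p} {q} f maps inj =
  ≤-trans (s≤s (injectiveOn⇒∣p∣≤∣q∣ (λ i i∈p → f (suc i) (there i∈p)) avoids-f₀
                 (λ i∈p j∈p eq → suc-injective (inj (there i∈p) (there j∈p) eq))))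
          (x∈p⇒∣p-x∣<∣p∣ (maps zero here))
  where
  avoids-f₀ : ∀ i (i∈p : i ∈ p) → f (suc i) (there i∈p) ∈ q - f zero here
  avoids-f₀ i i∈p = x∈p∧x≢y⇒x∈p-y (maps (suc i) (there i∈p))
                      (λ eq → 0≢1+n (inj here (there i∈p) (sym eq)))

injective⇒surjective : ∀ {f : Fin n → Fin n} → Injective _≡_ _≡_ f → ∀ y → ∃ λ x → f x ≡ y
injective⇒surjective {n} {f} f-inj y with any? (λ x → f x ≟ y)
... | yes hit  = hit
... | no  miss = ⊥-elim (<-irrefl refl (≤-trans (x∈p⇒∣p-x∣<∣p∣ (∈⊤ {x = y})) ∣⊤∣≤∣⊤-y∣))
  where
  ∣⊤∣≤∣⊤-y∣ : ∣ ⊤ {n} ∣ ≤ ∣ ⊤ - y ∣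
  ∣⊤∣≤∣⊤-y∣ = injectiveOn⇒∣p∣≤∣q∣ {p = ⊤} (λ x _ → f x)
                (λ x _ → x∈p∧x≢y⇒x∈p-y ∈⊤ (λ fx≡y → miss (x , fx≡y))) (λ _ _ → f-inj)

toSubset : ∀ {ℓ} {P : Pred (Fin n) ℓ} → Decidable P → Subset n
toSubset P? = tabulate (does ∘ P?)

module _ {ℓ} {P : Pred (Fin n) ℓ} (P? : Decidable P) where

  ∈-toSubset⁺ : ∀ {i} → P i → i ∈ toSubset P?
  ∈-toSubset⁺ {i} Pi = lookup⇒[]= i _ (trans (lookup∘tabulate (does ∘ P?) i) (dec-true (P? i) Pi))

  ∈-toSubset⁻ : ∀ {i} → i ∈ toSubset P? → P i
  ∈-toSubset⁻ {i} i∈ = from-does (P? i) (trans (sym (lookup∘tabulate (does ∘ P?) i)) ([]=⇒lookup i∈))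
    where
    from-does : ∀ {A : Set ℓ} (A? : Dec A) → does A? ≡ true → A
    from-does (yes a) _ = a

_⁻¹_ : (Fin m → Fin n) → Subset n → Subset m
f ⁻¹ q = toSubset (λ i → f i ∈? q)

image : (Fin m → Fin n) → Subset m → Subset n
image f p = toSubset (λ y → any? (λ x → x ∈? p ×-dec f x ≟ y))

module _ (f : Fin m → Fin n) where

  ∈-⁻¹⁺ : ∀ {q i} → f i ∈ q → i ∈ f ⁻¹ q
  ∈-⁻¹⁺ {q} = ∈-toSubset⁺ (λ i → f i ∈? q)

  ∈-⁻¹⁻ : ∀ q {i} → i ∈ f ⁻¹ q → f i ∈ q
  ∈-⁻¹⁻ q = ∈-toSubset⁻ (λ i → f i ∈? q)

  ∈-image⁺ : ∀ {p x} → x ∈ p → f x ∈ image f p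
  ∈-image⁺ {p} {x} x∈p = ∈-toSubset⁺ (λ y → any? (λ x → x ∈? p ×-dec f x ≟ y)) (x , x∈p , refl)

  ∈-image⁻ : ∀ p {y} → y ∈ image f p → ∃ λ x → x ∈ p × f x ≡ y
  ∈-image⁻ p = ∈-toSubset⁻ (λ y → any? (λ x → x ∈? p ×-dec f x ≟ y))

  ∣image∣≤∣p∣ : ∀ p → ∣ image f p ∣ ≤ ∣ p ∣
  ∣image∣≤∣p∣ p = injectiveOn⇒∣p∣≤∣q∣ (λ _ y∈ → proj₁ (∈-image⁻ p y∈))
    (λ _ y∈ → proj₁ (proj₂ (∈-image⁻ p y∈)))
    (λ y∈ y′∈ eq → trans (sym (proj₂ (proj₂ (∈-image⁻ p y∈))))
                         (trans (cong f eq) (proj₂ (proj₂ (∈-image⁻ p y′∈)))))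

module _ (f : Fin m → Fin n) {s} (s≤∣fibre∣ : ∀ y → s ≤ ∣ f ⁻¹ ⁅ y ⁆ ∣) where

  ∣q∣*s≤∣f⁻¹q∣ : ∀ q → ∣ q ∣ * s ≤ ∣ f ⁻¹ q ∣
  ∣q∣*s≤∣f⁻¹q∣ = WF.All.wfRec ⊂-wellFounded _ _ step
    where
    step : ∀ q → WF.WfRec _⊂_ (λ q → ∣ q ∣ * s ≤ ∣ f ⁻¹ q ∣) q → ∣ q ∣ * s ≤ ∣ f ⁻¹ q ∣
    step q rec with nonempty? q
    ... | no  empty rewrite Empty-unique empty | ∣⊥∣≡0 n = z≤n
    ... | yes (y , y∈q) = begin
      ∣ q ∣ * s                          ≤⟨ *-monoˡ-≤ s (∣p∣≤1+∣p-x∣ q y) ⟩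
      s + ∣ q - y ∣ * s                  ≤⟨ +-mono-≤ (s≤∣fibre∣ y) (rec (x∈p⇒p-x⊂p y∈q)) ⟩
      ∣ f ⁻¹ ⁅ y ⁆ ∣ + ∣ f ⁻¹ (q - y) ∣  ≤⟨ disjoint⇒∣p∣+∣q∣≤∣r∣ fibre⊆ rest⊆ disjoint ⟩
      ∣ f ⁻¹ q ∣                         ∎
      where
      open ≤-Reasoning
      fibre⊆ : f ⁻¹ ⁅ y ⁆ ⊆ f ⁻¹ q
      fibre⊆ i∈ = ∈-⁻¹⁺ f (subst (_∈ q) (sym (x∈⁅y⁆⇒x≡y y (∈-⁻¹⁻ f ⁅ y ⁆ i∈))) y∈q)
      rest⊆ : f ⁻¹ (q - y) ⊆ f ⁻¹ q
      rest⊆ i∈ = ∈-⁻¹⁺ f (p─q⊆p q ⁅ y ⁆ (∈-⁻¹⁻ f (q - y) i∈))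
      disjoint : ∀ {i} → i ∈ f ⁻¹ (q - y) → i ∉ f ⁻¹ ⁅ y ⁆
      disjoint i∈ i∈′ = x∈p─q⇒x∉q (∈-⁻¹⁻ f (q - y) i∈) (∈-⁻¹⁻ f ⁅ y ⁆ i∈′)

s+c≤x+1 : ∀ {s c x} → 1 ≤ s → s ≤ x → c * s ≤ x → s + c ≤ x + 1
s+c≤x+1 {s} {zero} {x} _ s≤x _ = begin
  s + 0  ≡⟨ +-identityʳ s ⟩
  s      ≤⟨ s≤x ⟩
  x      ≤⟨ m≤m+n x 1 ⟩
  x + 1  ∎
  where open ≤-Reasoning
s+c≤x+1 {suc s} {suc c} {x} _ _ c*s≤x = begin
  suc s + suc c            ≡⟨ +-suc (suc s) c ⟩
  suc (suc s + c)          ≤⟨ s≤s (+-monoʳ-≤ (suc s) (m≤m*n c (suc s))) ⟩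
  suc (suc s + c * suc s)  ≡⟨ +-comm 1 (suc c * suc s) ⟩
  suc c * suc s + 1        ≤⟨ +-monoˡ-≤ 1 c*s≤x ⟩
  x + 1                    ∎
  where open ≤-Reasoning

label-bound : ∀ {k x p s c} → k ≤ suc (x * x) → 1 ≤ s → p ≤ s + c → c * s ≤ x → p * s ≤ k + x →
              p ≤ x + 1
label-bound {k} {x} {p} {s} {c} k≤1+x² 1≤s p≤s+c c*s≤x p*s≤k+x with s ≤? x | p ≤? x + 1
... | yes s≤x | _         = ≤-trans p≤s+c (s+c≤x+1 1≤s s≤x c*s≤x)
... | no  _   | yes p≤x+1 = p≤x+1
... | no  s≰x | no  p≰x+1 = contradiction product≤ (<⇒≱ (m<m+n _ z<s))
  where
  open ≤-Reasoning
  expand : ∀ x → (suc (x * x) + x) + suc (x + x) ≡ suc (x + 1) * suc x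
  expand = solve-∀
  product≤ : (suc (x * x) + x) + suc (x + x) ≤ suc (x * x) + x
  product≤ = begin
    (suc (x * x) + x) + suc (x + x)  ≡⟨ expand x ⟩
    suc (x + 1) * suc x              ≤⟨ *-mono-≤ (≰⇒> p≰x+1) (≰⇒> s≰x) ⟩
    p * s                            ≤⟨ p*s≤k+x ⟩
    k + x                            ≤⟨ +-monoˡ-≤ x k≤1+x² ⟩
    suc (x * x) + x                  ∎

next : Fin n → Fin n
next {suc m} u with toℕ u <? m
... | yes u<m = fromℕ< (s≤s u<m)
... | no  _   = zero

CycleArc-next : ∀ (u : Fin n) → CycleArc n u (next u)
CycleArc-next {suc m} u with toℕ u <? m
... | yes u<m = inj₁ (sym (toℕ-fromℕ< (s≤s u<m)))
... | no  u≮m = inj₂ (cong suc (≤-antisym (toℕ≤pred[n] u) (≮⇒≥ u≮m)) , refl)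

module SmallestClass {p k} (P : LabeledPacking (suc p) (suc k) n) where

  open LabeledPacking P

  σ₀ : Fin n → Fin n
  σ₀ = σ zero

  class : Fin (suc p) → Subset n
  class l = label ⁻¹ ⁅ l ⁆

  a : Fin (suc p)
  a = argmin (∣_∣ ∘ class) zero (allFin _)

  s : ℕ
  s = ∣ class a ∣

  s≤∣class∣ : ∀ l → s ≤ ∣ class l ∣
  s≤∣class∣ l = ListAll.lookup (f[argmin]≤f[xs] {f = ∣_∣ ∘ class} zero (allFin _)) (∈-allFin l)

  t : Fin n
  t = proj₁ (label-onto a)

  t∈class : t ∈ class a
  t∈class = ∈-⁻¹⁺ label (subst (_∈ ⁅ a ⁆) (sym (proj₂ (label-onto a))) (x∈⁅x⁆ a))

  1≤s : 1 ≤ s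
  1≤s = ≤-trans (s≤s z≤n) (x∈p⇒∣p-x∣<∣p∣ t∈class)

  nextLabels : Subset (suc p)
  nextLabels = image (label ∘ σ₀ ∘ next) ((label ∘ σ₀) ⁻¹ ⁅ a ⁆)

  ∣nextLabels∣≤s : ∣ nextLabels ∣ ≤ s
  ∣nextLabels∣≤s = ≤-trans (∣image∣≤∣p∣ (label ∘ σ₀ ∘ next) _)
    (injectiveOn⇒∣p∣≤∣q∣ (λ u _ → σ₀ u)
      (λ u u∈ → ∈-⁻¹⁺ label (∈-⁻¹⁻ (label ∘ σ₀) ⁅ a ⁆ u∈)) (λ _ _ → σ-inj zero))

  u : Fin (suc k) → Fin n
  u i = proj₁ (injective⇒surjective (σ-inj i) t)

  σu≡t : ∀ i → σ i (u i) ≡ t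
  σu≡t i = proj₂ (injective⇒surjective (σ-inj i) t)

  head : Fin (suc k) → Fin n
  head i = σ i (next (u i))

  head-injective : Injective _≡_ _≡_ head
  head-injective {i} {j} eq with i ≟ j
  ... | yes i≡j = i≡j
  ... | no  i≢j = ⊥-elim (arc-disj i j i≢j _ _ _ _ (CycleArc-next (u i)) (CycleArc-next (u j))
                            (trans (σu≡t i) (sym (σu≡t j))) eq)

  label-head∈nextLabels : ∀ i → label (head i) ∈ nextLabels
  label-head∈nextLabels i =
    subst (_∈ nextLabels) (label-eq zero i (next (u i)))
      (∈-image⁺ (label ∘ σ₀ ∘ next) (∈-⁻¹⁺ (label ∘ σ₀)
        (subst (_∈ ⁅ a ⁆) (sym label-σ₀u≡a) (x∈⁅x⁆ a))))
    where
    label-σ₀u≡a : label (σ₀ (u i)) ≡ a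
    label-σ₀u≡a = trans (label-eq zero i (u i)) (trans (cong label (σu≡t i)) (proj₂ (label-onto a)))

  copies≤∣label⁻¹nextLabels∣ : suc k ≤ ∣ label ⁻¹ nextLabels ∣
  copies≤∣label⁻¹nextLabels∣ = subst (_≤ ∣ label ⁻¹ nextLabels ∣) (∣⊤∣≡n (suc k))
    (injectiveOn⇒∣p∣≤∣q∣ {p = ⊤} (λ i _ → head i) (λ i _ → ∈-⁻¹⁺ label (label-head∈nextLabels i))
      (λ _ _ → head-injective))

  labels≤s+∣∁nextLabels∣ : suc p ≤ s + ∣ ∁ nextLabels ∣
  labels≤s+∣∁nextLabels∣ = subst (_≤ s + ∣ ∁ nextLabels ∣) (∣p∣+∣∁p∣≡n nextLabels)
    (+-monoˡ-≤ ∣ ∁ nextLabels ∣ ∣nextLabels∣≤s)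

  copies+∣∁nextLabels∣*s≤n : suc k + ∣ ∁ nextLabels ∣ * s ≤ n
  copies+∣∁nextLabels∣*s≤n = begin
    suc k + ∣ ∁ nextLabels ∣ * s                          ≤⟨ +-mono-≤ copies≤∣label⁻¹nextLabels∣
                                                               (∣q∣*s≤∣f⁻¹q∣ label s≤∣class∣ (∁ nextLabels)) ⟩
    ∣ label ⁻¹ nextLabels ∣ + ∣ label ⁻¹ ∁ nextLabels ∣  ≤⟨ disjoint⇒∣p∣+∣q∣≤∣r∣ (λ _ → ∈⊤) (λ _ → ∈⊤)
                                                               (λ i∈ i∈′ → x∈∁p⇒x∉p (∈-⁻¹⁻ label _ i∈) (∈-⁻¹⁻ label _ i∈′)) ⟩
    ∣ ⊤ {n} ∣                                              ≡⟨ ∣⊤∣≡n n ⟩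
    n                                                      ∎
    where open ≤-Reasoning

  labels*s≤n : suc p * s ≤ n
  labels*s≤n = begin
    suc p * s              ≡⟨ cong (_* s) (∣⊤∣≡n (suc p)) ⟨
    ∣ ⊤ {suc p} ∣ * s      ≤⟨ ∣q∣*s≤∣f⁻¹q∣ label s≤∣class∣ ⊤ ⟩
    ∣ label ⁻¹ ⊤ ∣         ≤⟨ ∣p∣≤n (label ⁻¹ ⊤) ⟩
    n                      ∎
    where open ≤-Reasoning

mainTheorem13 : ∀ (k x : ℕ) → 2 ≤ k → 1 ≤ x → x ≤ k ∸ 1 →
    ¬ ((x ≡ 1) × (k + x ≡ 4)) → ¬ ((x ≡ 1) × (k + x ≡ 6)) →
    k ∸ 1 ≤ x * x →
    ∀ (p : ℕ) → LabeledPacking p k (k + x) → p ≤ x + 2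
-- The argument gives p ≤ x + 1 from k − 1 ≤ x² alone.
mainTheorem13 zero    x () _ _ _ _ _ _ _
mainTheorem13 (suc k) x _ _ _ _ _ k≤x² zero    P = z≤n
mainTheorem13 (suc k) x _ _ _ _ _ k≤x² (suc p) P =
  ≤-trans (label-bound (s≤s k≤x²) 1≤s labels≤s+∣∁nextLabels∣
             (+-cancelˡ-≤ (suc k) _ _ copies+∣∁nextLabels∣*s≤n) labels*s≤n)
          (+-monoʳ-≤ x (n≤1+n 1))
  where open SmallestClass P
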